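{- The overlap graph of a permutation cannot have property $b$.
   Context: For a permutation $\pi=[a_1,\dots,a_n]$, frame it as $0,a_1,\dots,a_n,n+1$; each entry $k$ has a left pointer $(k-1,k)$ to its left and a right pointer $(k,k+1)$ to its right (no left pointer for $0$, no right pointer for $n+1$), so each pointer $(i,i+1)$, $0\le i\le n$, occurs twice in the resulting left-to-right sequence. The overlap graph has one vertex per pointer $(i,i+1)$, two vertices adjacent iff their occurrences interleave (exactly one occurrence of one lies strictly between the two occurrences of the other); its roots are the vertices $x=(0,1)$ and $y=(n,n+1)$. A parity cut (in this definition) of a two-rooted graph $(V,E)$ is a partition $V=V_1\cup V_2$ into disjoint sets such that every non-root vertex has an even number of neighbours in the part not containing it; for a vertex $v$ and set $S$, $\delta_S(v)$ is the number of neighbours of $v$ in $S$. The graph has property $b$ if there is such a parity cut with $x\in V_1$, $y\in V_2$, and both $\delta_{V_2}(x)$ and $\delta_{V_1}(y)$ odd. -}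

module Defs where

open import Data.Bool using (Bool; true; false; if_then_else_; _∧_; _∨_; not)
open import Data.Nat using (ℕ; zero; suc; _+_; _∸_; _%_; _≡ᵇ_)
open import Data.Fin using (Fin; toℕ; fromℕ)
open import Data.List using (List; []; _∷_; _++_; [_]; map; concatMap; allFin)
open import Data.Nat.ListAction using (sum)
open import Data.Fin.Permutation using (Permutation′; _⟨$⟩ʳ_)
open import Data.Product using (Σ; _×_; _,_)
open import Relation.Binary.PropositionalEquality using (_≡_; _≢_)

-- A permutation π = [a_1,…,a_n] of {1,…,n} is given by a bijection
-- σ : Fin n ↔ Fin n, with a_{i+1} = toℕ (σ i) + 1.

framed : (n : ℕ) → Permutation′ n → List ℕ
framed n σ = 0 ∷ (map (λ i → suc (toℕ (σ ⟨$⟩ʳ i))) (allFin n) ++ [ suc n ])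

-- The pointer (i, i+1) is encoded by the natural number i (0 ≤ i ≤ n).
-- Entry k contributes its left pointer (k-1,k) (if k ≠ 0) followed by
-- its right pointer (k,k+1) (if k ≠ n+1).
pointersOf : (n : ℕ) → ℕ → List ℕ
pointersOf n k =
  (if k ≡ᵇ 0 then [] else [ k ∸ 1 ]) ++ (if k ≡ᵇ suc n then [] else [ k ])

pointerSeq : (n : ℕ) → Permutation′ n → List ℕ
pointerSeq n σ = concatMap (pointersOf n) (framed n σ)

-- number of occurrences of j strictly between the (first) two occurrences
-- of i in a list; s = number of occurrences of i seen so far
betweenCount : ℕ → ℕ → ℕ → List ℕ → ℕ
betweenCount i j s [] = 0
betweenCount i j s (x ∷ xs) =
  if x ≡ᵇ i then betweenCount i j (suc s) xs
  else (if (x ≡ᵇ j) ∧ (s ≡ᵇ 1) then suc (betweenCount i j s xs)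
        else betweenCount i j s xs)

interleave : List ℕ → ℕ → ℕ → Bool
interleave w i j =
  not (i ≡ᵇ j) ∧ ((betweenCount i j 0 w ≡ᵇ 1) ∨ (betweenCount j i 0 w ≡ᵇ 1))

record TwoRootedGraph : Set where
  field
    m    : ℕ
    adj  : Fin m → Fin m → Bool
    x    : Fin m
    y    : Fin m

-- the overlap graph of a permutation: vertex i : Fin (n+1) is the pointer
-- (i, i+1); roots x = (0,1) and y = (n,n+1)
overlapGraph : (n : ℕ) → Permutation′ n → TwoRootedGraph
overlapGraph n σ = record
  { m   = suc n
  ; adj = λ u v → interleave (pointerSeq n σ) (toℕ u) (toℕ v)
  ; x   = Fin.zero
  ; y   = fromℕ n
  }

module _ (G : TwoRootedGraph) where
  open TwoRootedGraph G

  δ : (Fin m → Bool) → Fin m → ℕ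
  δ S v = sum (map (λ u → if adj v u ∧ S u then 1 else 0) (allFin m))

  Even Odd : ℕ → Set
  Even k = k % 2 ≡ 0
  Odd  k = k % 2 ≡ 1

  V₁ V₂ : (Fin m → Bool) → Fin m → Bool
  V₁ side v = not (side v)
  V₂ side v = side v

  otherPart : (Fin m → Bool) → Fin m → (Fin m → Bool)
  otherPart side v = if side v then V₁ side else V₂ side

  IsParityCut : (Fin m → Bool) → Set
  IsParityCut side =
    ∀ v → v ≢ x → v ≢ y → Even (δ (otherPart side v) v)

  PropertyB : Set
  PropertyB = Σ (Fin m → Bool) λ side →
    IsParityCut side × side x ≡ false × side y ≡ true ×
    Odd (δ (V₂ side) x) × Odd (δ (V₁ side) y)

-- Write the pointer sequence as 0, c₁, c₁+1, …, cₙ, cₙ+1, n with cᵢ = aᵢ − 1. The number of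
-- neighbours of v in the part not containing v has the parity of the number of entries strictly
-- between the two occurrences of v that lie in that part, which is the xor of the prefix parities
-- at the two occurrences. Let Rᵢ be the parity of the number of V₂-entries among 0, c₁, c₁+1, …, cᵢ.
-- The part not containing v is V₂ shifted by the colour of v, and the shift cancels over complete
-- pairs, so the parity at v is Rᵢ ⊕ Rⱼ where cᵢ = v and cⱼ + 1 = v (the second term is absent for
-- v = 0). Odd parity at x and even parity at the other non-root vertices force every Rᵢ = 1, i.e.
-- c₁ ∈ V₂ and cᵢ₊₁ ∈ V₂ ⇔ cᵢ + 1 ∈ V₂. Counting V₂-entries among the cᵢ (a rearrangement of
-- 0, …, n−1) and among the cᵢ + 1 (a rearrangement of 1, …, n) then shows that cₙ + 1 would have
-- to be counted twice.

module Submission where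

open import Algebra.Bundles using (CommutativeRing)
import Algebra.Properties.CommutativeMonoid.Sum as FinSum
open import Data.Bool using (Bool; true; false; if_then_else_; _∧_; _∨_; not; _xor_)
open import Data.Bool.Properties
  using ( xor-∧-commutativeRing; not-distribˡ-xor; not-involutive; xor-assoc; xor-comm; xor-same
        ; xor-identityʳ; ∧-distribˡ-xor; ∧-distribʳ-xor; ∧-zeroʳ; ∧-comm )
open import Data.Empty using (⊥; ⊥-elim)
open import Data.Fin using (Fin; toℕ; fromℕ; fromℕ<; inject₁)
open import Data.Fin.Permutation using (Permutation′; _⟨$⟩ʳ_; _⟨$⟩ˡ_; inverseˡ)
open import Data.Fin.Properties using (toℕ<n; toℕ-fromℕ<; toℕ-fromℕ; toℕ-inject₁)
open import Data.List using (List; []; _∷_; _++_; [_]; map; concatMap; allFin; tabulate)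
open import Data.List.Properties using (map-tabulate; concatMap-++)
open import Data.Nat using (ℕ; zero; suc; _+_; _%_; _≡ᵇ_; _<_; _≤_; z≤n; s≤s)
open import Data.Nat.DivMod using ([m+n]%n≡m%n)
open import Data.Nat.ListAction using (sum)
open import Data.Nat.Properties
  using ( +-0-commutativeMonoid; +-comm; +-assoc; +-suc; +-identityʳ; +-cancelˡ-≡; 0≢1+n; suc-injective
        ; m≤n+m; ≤-trans; ≤-pred; <-irrefl; <-trans; n<1+n; m<n⇒m<1+n )
open import Data.Nat.Tactic.RingSolver using (solve-∀)
open import Data.Product using (_,_)
open import Function using (_∘_; id)
open import Relation.Binary.PropositionalEquality hiding ([_])
open import Relation.Nullary using (¬_)

open import Defs

module ℕΣ = FinSum +-0-commutativeMonoid
module ⊕Σ = FinSum (CommutativeRing.+-commutativeMonoid xor-∧-commutativeRing)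

open ⊕Σ using () renaming (sum to ⨁)

odd : ℕ → Bool
odd zero    = false
odd (suc k) = not (odd k)

bit : Bool → ℕ
bit b = if b then 1 else 0

odd-+ : ∀ a b → odd (a + b) ≡ odd a xor odd b
odd-+ zero    b = refl
odd-+ (suc a) b = trans (cong not (odd-+ a b)) (not-distribˡ-xor (odd a) (odd b))

odd-sum-tabulate : ∀ {m} (g : Fin m → Bool) → odd (sum (tabulate (bit ∘ g))) ≡ ⨁ g
odd-sum-tabulate {zero}  g = refl
odd-sum-tabulate {suc m} g with g Fin.zero
... | true  = cong not (odd-sum-tabulate (g ∘ Fin.suc))
... | false = odd-sum-tabulate (g ∘ Fin.suc)

%2≡bit-odd : ∀ k → k % 2 ≡ bit (odd k)
%2≡bit-odd zero          = refl
%2≡bit-odd (suc zero)    = refl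
%2≡bit-odd (suc (suc k)) = begin
  (2 + k) % 2         ≡⟨ cong (_% 2) (+-comm 2 k) ⟩
  (k + 2) % 2         ≡⟨ [m+n]%n≡m%n k 2 ⟩
  k % 2               ≡⟨ %2≡bit-odd k ⟩
  bit (odd k)         ≡⟨ cong bit (sym (not-involutive (odd k))) ⟩
  bit (odd (2 + k))   ∎
  where open ≡-Reasoning

odd-true : ∀ k → k % 2 ≡ 1 → odd k ≡ true
odd-true k k%2≡1 with odd k | %2≡bit-odd k
... | true  | _ = refl
... | false | q = ⊥-elim (0≢1+n (trans (sym q) k%2≡1))

odd-false : ∀ k → k % 2 ≡ 0 → odd k ≡ false
odd-false k k%2≡0 with odd k | %2≡bit-odd k
... | false | _ = refl
... | true  | q = ⊥-elim (0≢1+n (trans (sym k%2≡0) q))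

odd-if : ∀ b k → odd (if b then suc k else k) ≡ b xor odd k
odd-if true  k = refl
odd-if false k = refl

-- Interleaving as the parity of a count

≡ᵇ-refl : ∀ a → (a ≡ᵇ a) ≡ true
≡ᵇ-refl zero    = refl
≡ᵇ-refl (suc a) = ≡ᵇ-refl a

≡ᵇ⇒≡′ : ∀ a b → (a ≡ᵇ b) ≡ true → a ≡ b
≡ᵇ⇒≡′ zero    zero    _ = refl
≡ᵇ⇒≡′ (suc a) (suc b) p = cong suc (≡ᵇ⇒≡′ a b p)

≡ᵇ-comm : ∀ a b → (a ≡ᵇ b) ≡ (b ≡ᵇ a)
≡ᵇ-comm zero    zero    = refl
≡ᵇ-comm zero    (suc b) = refl
≡ᵇ-comm (suc a) zero    = refl
≡ᵇ-comm (suc a) (suc b) = ≡ᵇ-comm a b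

xor≡false⇒≡ : ∀ {a b} → a xor b ≡ false → a ≡ b
xor≡false⇒≡ {false} {false} _ = refl
xor≡false⇒≡ {true}  {true}  _ = refl

suc[m+n]≡2⇒n≤1 : ∀ m n → suc (m + n) ≡ 2 → n ≤ 1
suc[m+n]≡2⇒n≤1 m n p = subst (n ≤_) (suc-injective p) (m≤n+m n m)

multiplicity : ℕ → List ℕ → ℕ
multiplicity a []       = 0
multiplicity a (x ∷ xs) = bit (x ≡ᵇ a) + multiplicity a xs

between : ℕ → ℕ → List ℕ → List ℕ
between i s []       = []
between i s (x ∷ xs) =
  if x ≡ᵇ i then between i (suc s) xs
  else (if s ≡ᵇ 1 then x ∷ between i s xs else between i s xs)

betweenCount≡multiplicity-between : ∀ i j s w → betweenCount i j s w ≡ multiplicity j (between i s w)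
betweenCount≡multiplicity-between i j s []       = refl
betweenCount≡multiplicity-between i j s (x ∷ w) with x ≡ᵇ i
... | true  = betweenCount≡multiplicity-between i j (suc s) w
... | false with s ≡ᵇ 1
...   | false rewrite ∧-zeroʳ (x ≡ᵇ j) = betweenCount≡multiplicity-between i j s w
...   | true with x ≡ᵇ j
...     | true  = cong suc (betweenCount≡multiplicity-between i j s w)
...     | false = betweenCount≡multiplicity-between i j s w

betweenCount-self : ∀ i s w → betweenCount i i s w ≡ 0
betweenCount-self i s []      = refl
betweenCount-self i s (x ∷ w) with x ≡ᵇ i
... | true  = betweenCount-self i (suc s) w
... | false = betweenCount-self i s w

betweenCount≤multiplicity : ∀ i j s w → betweenCount i j s w ≤ multiplicity j w
betweenCount≤multiplicity i j s []      = z≤n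
betweenCount≤multiplicity i j s (x ∷ w) with x ≡ᵇ i | x ≡ᵇ j | s ≡ᵇ 1
... | true  | _     | _     = ≤-trans (betweenCount≤multiplicity i j (suc s) w) (m≤n+m _ _)
... | false | true  | true  = s≤s (betweenCount≤multiplicity i j s w)
... | false | true  | false = ≤-trans (betweenCount≤multiplicity i j s w) (m≤n+m _ 1)
... | false | false | _     = betweenCount≤multiplicity i j s w

module _ {i j : ℕ} (i≢j : (i ≡ᵇ j) ≡ false) where

  private
    reorder : ∀ a b c → a xor (b xor c) ≡ (a xor c) xor b
    reorder a b c = trans (cong (a xor_) (xor-comm b c)) (sym (xor-assoc a c b))

    toggle-inside : ∀ s b → s ≤ 1 → ((suc s ≡ᵇ 1) ∧ b) xor b ≡ (s ≡ᵇ 1) ∧ b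
    toggle-inside .0 b z≤n       = xor-same b
    toggle-inside .1 b (s≤s z≤n) = refl

    no-common-element : ∀ x → (x ≡ᵇ i) ≡ true → (x ≡ᵇ j) ≡ true → ⊥
    no-common-element x x≡i x≡j
      with () ← trans (sym i≢j) (subst (λ k → (i ≡ᵇ k) ≡ true) (trans (sym (≡ᵇ⇒≡′ x i x≡i)) (≡ᵇ⇒≡′ x j x≡j)) (≡ᵇ-refl i))

  odd-betweenCount-sym : ∀ w si sj → multiplicity i w + si ≡ 2 → multiplicity j w + sj ≡ 2 →
    odd (betweenCount i j si w) xor odd (betweenCount j i sj w) ≡ (si ≡ᵇ 1) ∧ (sj ≡ᵇ 1)
  odd-betweenCount-sym []      .2 .2 refl refl = refl
  odd-betweenCount-sym (x ∷ w) si sj hi hj with x ≡ᵇ i in x≡i | x ≡ᵇ j in x≡j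
  ... | true  | true  = ⊥-elim (no-common-element x x≡i x≡j)
  ... | false | false = odd-betweenCount-sym w si sj hi hj
  ... | true  | false = begin
    odd (betweenCount i j (suc si) w) xor odd (if sj ≡ᵇ 1 then suc (betweenCount j i sj w) else betweenCount j i sj w)
      ≡⟨ cong (odd (betweenCount i j (suc si) w) xor_) (odd-if (sj ≡ᵇ 1) (betweenCount j i sj w)) ⟩
    odd (betweenCount i j (suc si) w) xor ((sj ≡ᵇ 1) xor odd (betweenCount j i sj w))
      ≡⟨ reorder (odd (betweenCount i j (suc si) w)) (sj ≡ᵇ 1) (odd (betweenCount j i sj w)) ⟩
    (odd (betweenCount i j (suc si) w) xor odd (betweenCount j i sj w)) xor (sj ≡ᵇ 1)
      ≡⟨ cong (_xor (sj ≡ᵇ 1)) (odd-betweenCount-sym w (suc si) sj (trans (+-suc _ si) hi) hj) ⟩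
    ((suc si ≡ᵇ 1) ∧ (sj ≡ᵇ 1)) xor (sj ≡ᵇ 1)
      ≡⟨ toggle-inside si (sj ≡ᵇ 1) (suc[m+n]≡2⇒n≤1 (multiplicity i w) si hi) ⟩
    (si ≡ᵇ 1) ∧ (sj ≡ᵇ 1) ∎
    where open ≡-Reasoning
  ... | false | true  = begin
    odd (if si ≡ᵇ 1 then suc (betweenCount i j si w) else betweenCount i j si w) xor odd (betweenCount j i (suc sj) w)
      ≡⟨ cong (_xor odd (betweenCount j i (suc sj) w)) (odd-if (si ≡ᵇ 1) (betweenCount i j si w)) ⟩
    ((si ≡ᵇ 1) xor odd (betweenCount i j si w)) xor odd (betweenCount j i (suc sj) w)
      ≡⟨ xor-assoc (si ≡ᵇ 1) _ _ ⟩
    (si ≡ᵇ 1) xor (odd (betweenCount i j si w) xor odd (betweenCount j i (suc sj) w))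
      ≡⟨ cong ((si ≡ᵇ 1) xor_) (odd-betweenCount-sym w si (suc sj) hi (trans (+-suc _ sj) hj)) ⟩
    (si ≡ᵇ 1) xor ((si ≡ᵇ 1) ∧ (suc sj ≡ᵇ 1))
      ≡⟨ cong ((si ≡ᵇ 1) xor_) (∧-comm (si ≡ᵇ 1) (suc sj ≡ᵇ 1)) ⟩
    (si ≡ᵇ 1) xor ((suc sj ≡ᵇ 1) ∧ (si ≡ᵇ 1))
      ≡⟨ xor-comm (si ≡ᵇ 1) _ ⟩
    ((suc sj ≡ᵇ 1) ∧ (si ≡ᵇ 1)) xor (si ≡ᵇ 1)
      ≡⟨ toggle-inside sj (si ≡ᵇ 1) (suc[m+n]≡2⇒n≤1 (multiplicity j w) sj hj) ⟩
    (sj ≡ᵇ 1) ∧ (si ≡ᵇ 1)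
      ≡⟨ ∧-comm (sj ≡ᵇ 1) (si ≡ᵇ 1) ⟩
    (si ≡ᵇ 1) ∧ (sj ≡ᵇ 1) ∎
    where open ≡-Reasoning

exactly-one-between : ∀ {a b} → a ≤ 2 → b ≤ 2 → odd a ≡ odd b → ((a ≡ᵇ 1) ∨ (b ≡ᵇ 1)) ≡ odd a
exactly-one-between z≤n             z≤n             _ = refl
exactly-one-between z≤n             (s≤s (s≤s z≤n)) _ = refl
exactly-one-between (s≤s z≤n)       _               _ = refl
exactly-one-between (s≤s (s≤s z≤n)) z≤n             _ = refl
exactly-one-between (s≤s (s≤s z≤n)) (s≤s (s≤s z≤n)) _ = refl
exactly-one-between z≤n             (s≤s z≤n)       ()
exactly-one-between (s≤s (s≤s z≤n)) (s≤s z≤n)       ()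

interleave≡odd-betweenCount : ∀ w i j → multiplicity i w ≡ 2 → multiplicity j w ≡ 2 →
  interleave w i j ≡ odd (betweenCount i j 0 w)
interleave≡odd-betweenCount w i j hi hj with i ≡ᵇ j in i≡ᵇj
... | true rewrite ≡ᵇ⇒≡′ i j i≡ᵇj = sym (cong odd (betweenCount-self j 0 w))
... | false = exactly-one-between
  (subst (betweenCount i j 0 w ≤_) hj (betweenCount≤multiplicity i j 0 w))
  (subst (betweenCount j i 0 w ≤_) hi (betweenCount≤multiplicity j i 0 w))
  (xor≡false⇒≡ (odd-betweenCount-sym i≡ᵇj w 0 0 (trans (+-identityʳ _) hi) (trans (+-identityʳ _) hj)))

-- Degree parities in the overlap graph

extendℕ : ∀ {m} → (Fin m → Bool) → ℕ → Bool
extendℕ {zero}  g k       = false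
extendℕ {suc m} g zero    = g Fin.zero
extendℕ {suc m} g (suc k) = extendℕ (g ∘ Fin.suc) k

extendℕ-toℕ : ∀ {m} (g : Fin m → Bool) u → extendℕ g (toℕ u) ≡ g u
extendℕ-toℕ g Fin.zero    = refl
extendℕ-toℕ g (Fin.suc u) = extendℕ-toℕ (g ∘ Fin.suc) u

⨁-indicator : ∀ {m} (g : Fin m → Bool) x → ⨁ (λ u → (toℕ u ≡ᵇ x) ∧ g u) ≡ extendℕ g x
⨁-indicator {zero}  g x       = refl
⨁-indicator {suc m} g zero    = trans (cong (g Fin.zero xor_) (⊕Σ.sum-replicate-zero m)) (xor-identityʳ (g Fin.zero))
⨁-indicator {suc m} g (suc x) = ⨁-indicator (g ∘ Fin.suc) x

xorMap : (ℕ → Bool) → List ℕ → Bool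
xorMap f []       = false
xorMap f (x ∷ xs) = f x xor xorMap f xs

odd-bit : ∀ b → odd (bit b) ≡ b
odd-bit true  = refl
odd-bit false = refl

⨁-odd-multiplicity : ∀ {m} (S : Fin m → Bool) L →
  ⨁ (λ u → S u ∧ odd (multiplicity (toℕ u) L)) ≡ xorMap (extendℕ S) L
⨁-odd-multiplicity {m} S []      = trans (⊕Σ.sum-cong-≗ (λ u → ∧-zeroʳ (S u))) (⊕Σ.sum-replicate-zero m)
⨁-odd-multiplicity {m} S (x ∷ L) = begin
  ⨁ (λ u → S u ∧ odd (bit (x ≡ᵇ toℕ u) + multiplicity (toℕ u) L))
    ≡⟨ ⊕Σ.sum-cong-≗ split ⟩
  ⨁ (λ u → ((toℕ u ≡ᵇ x) ∧ S u) xor (S u ∧ odd (multiplicity (toℕ u) L)))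
    ≡⟨ ⊕Σ.∑-distrib-+ (λ u → (toℕ u ≡ᵇ x) ∧ S u) (λ u → S u ∧ odd (multiplicity (toℕ u) L)) ⟩
  ⨁ (λ u → (toℕ u ≡ᵇ x) ∧ S u) xor ⨁ (λ u → S u ∧ odd (multiplicity (toℕ u) L))
    ≡⟨ cong₂ _xor_ (⨁-indicator S x) (⨁-odd-multiplicity S L) ⟩
  extendℕ S x xor xorMap (extendℕ S) L ∎
  where
  open ≡-Reasoning
  split : ∀ u → S u ∧ odd (bit (x ≡ᵇ toℕ u) + multiplicity (toℕ u) L)
              ≡ ((toℕ u ≡ᵇ x) ∧ S u) xor (S u ∧ odd (multiplicity (toℕ u) L))
  split u = begin
    S u ∧ odd (bit (x ≡ᵇ toℕ u) + multiplicity (toℕ u) L)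
      ≡⟨ cong (S u ∧_) (trans (odd-+ (bit (x ≡ᵇ toℕ u)) _) (cong (_xor _) (odd-bit (x ≡ᵇ toℕ u)))) ⟩
    S u ∧ ((x ≡ᵇ toℕ u) xor odd (multiplicity (toℕ u) L))
      ≡⟨ ∧-distribˡ-xor (S u) (x ≡ᵇ toℕ u) _ ⟩
    (S u ∧ (x ≡ᵇ toℕ u)) xor (S u ∧ odd (multiplicity (toℕ u) L))
      ≡⟨ cong (_xor _) (trans (∧-comm (S u) _) (cong (_∧ S u) (≡ᵇ-comm x (toℕ u)))) ⟩
    ((toℕ u ≡ᵇ x) ∧ S u) xor (S u ∧ odd (multiplicity (toℕ u) L)) ∎

odd-δ : ∀ G S v → odd (δ G S v) ≡ ⨁ (λ u → TwoRootedGraph.adj G v u ∧ S u)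
odd-δ G S v = trans (cong (odd ∘ sum) (map-tabulate id (bit ∘ adjacent-in-S))) (odd-sum-tabulate adjacent-in-S)
  where
  adjacent-in-S : Fin (TwoRootedGraph.m G) → Bool
  adjacent-in-S u = TwoRootedGraph.adj G v u ∧ S u

odd-δ-overlapGraph : ∀ n σ → (∀ (u : Fin (suc n)) → multiplicity (toℕ u) (pointerSeq n σ) ≡ 2) →
  ∀ S v → odd (δ (overlapGraph n σ) S v) ≡ xorMap (extendℕ S) (between (toℕ v) 0 (pointerSeq n σ))
odd-δ-overlapGraph n σ twice S v = begin
  odd (δ (overlapGraph n σ) S v)
    ≡⟨ odd-δ (overlapGraph n σ) S v ⟩
  ⨁ (λ u → interleave w (toℕ v) (toℕ u) ∧ S u)
    ≡⟨ ⊕Σ.sum-cong-≗ interleave-as-odd ⟩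
  ⨁ (λ u → S u ∧ odd (multiplicity (toℕ u) (between (toℕ v) 0 w)))
    ≡⟨ ⨁-odd-multiplicity S (between (toℕ v) 0 w) ⟩
  xorMap (extendℕ S) (between (toℕ v) 0 w) ∎
  where
  open ≡-Reasoning
  w = pointerSeq n σ
  interleave-as-odd : ∀ u → interleave w (toℕ v) (toℕ u) ∧ S u ≡ S u ∧ odd (multiplicity (toℕ u) (between (toℕ v) 0 w))
  interleave-as-odd u = begin
    interleave w (toℕ v) (toℕ u) ∧ S u
      ≡⟨ cong (_∧ S u) (interleave≡odd-betweenCount w (toℕ v) (toℕ u) (twice v) (twice u)) ⟩
    odd (betweenCount (toℕ v) (toℕ u) 0 w) ∧ S u
      ≡⟨ cong (λ k → odd k ∧ S u) (betweenCount≡multiplicity-between (toℕ v) (toℕ u) 0 w) ⟩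
    odd (multiplicity (toℕ u) (between (toℕ v) 0 w)) ∧ S u
      ≡⟨ ∧-comm _ (S u) ⟩
    S u ∧ odd (multiplicity (toℕ u) (between (toℕ v) 0 w)) ∎

-- The pointer sequence of a permutation

leftPointer : ∀ {n} → Permutation′ n → Fin n → ℕ
leftPointer σ i = toℕ (σ ⟨$⟩ʳ i)

pointerPairs : ∀ {k} → (Fin k → ℕ) → List ℕ
pointerPairs {zero}  c = []
pointerPairs {suc k} c = c Fin.zero ∷ suc (c Fin.zero) ∷ pointerPairs (c ∘ Fin.suc)

<⇒≡ᵇ-false : ∀ {a n} → a < n → (a ≡ᵇ n) ≡ false
<⇒≡ᵇ-false {zero}  {suc n} _         = refl
<⇒≡ᵇ-false {suc a} {suc n} (s≤s a<n) = <⇒≡ᵇ-false a<n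

pointerSeq-shape : ∀ n σ → pointerSeq n σ ≡ 0 ∷ pointerPairs (leftPointer σ) ++ [ n ]
pointerSeq-shape n σ = cong (0 ∷_) (begin
  concatMap (pointersOf n) (map entry (allFin n) ++ [ suc n ])
    ≡⟨ concatMap-++ (pointersOf n) (map entry (allFin n)) [ suc n ] ⟩
  concatMap (pointersOf n) (map entry (allFin n)) ++ pointersOf n (suc n) ++ []
    ≡⟨ cong₂ (λ xs b → xs ++ (n ∷ (if b then [] else [ suc n ])) ++ [])
             (cong (concatMap (pointersOf n)) (map-tabulate id entry)) (≡ᵇ-refl n) ⟩
  concatMap (pointersOf n) (tabulate entry) ++ [ n ]
    ≡⟨ cong (_++ [ n ]) (pairs (σ ⟨$⟩ʳ_)) ⟩
  pointerPairs (leftPointer σ) ++ [ n ] ∎)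
  where
  open ≡-Reasoning
  entry : Fin n → ℕ
  entry i = suc (toℕ (σ ⟨$⟩ʳ i))
  pairs : ∀ {k} (g : Fin k → Fin n) →
    concatMap (pointersOf n) (tabulate (λ i → suc (toℕ (g i)))) ≡ pointerPairs (toℕ ∘ g)
  pairs {zero}  g = refl
  pairs {suc k} g rewrite <⇒≡ᵇ-false (toℕ<n (g Fin.zero)) = cong (λ xs → toℕ (g Fin.zero) ∷ suc (toℕ (g Fin.zero)) ∷ xs) (pairs (g ∘ Fin.suc))

multiplicity-++ : ∀ a xs ys → multiplicity a (xs ++ ys) ≡ multiplicity a xs + multiplicity a ys
multiplicity-++ a []       ys = refl
multiplicity-++ a (x ∷ xs) ys = trans (cong (bit (x ≡ᵇ a) +_) (multiplicity-++ a xs ys)) (sym (+-assoc (bit (x ≡ᵇ a)) _ _))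

multiplicity-pointerPairs : ∀ a {k} (c : Fin k → ℕ) →
  multiplicity a (pointerPairs c) ≡ ℕΣ.sum (λ i → bit (c i ≡ᵇ a) + bit (suc (c i) ≡ᵇ a))
multiplicity-pointerPairs a {zero}  c = refl
multiplicity-pointerPairs a {suc k} c =
  trans (cong (λ r → bit (c Fin.zero ≡ᵇ a) + (bit (suc (c Fin.zero) ≡ᵇ a) + r)) (multiplicity-pointerPairs a (c ∘ Fin.suc)))
        (sym (+-assoc (bit (c Fin.zero ≡ᵇ a)) _ _))

left-pointer-count : ∀ n a → a ≤ n → ℕΣ.sum {n} (λ j → bit (toℕ j ≡ᵇ a)) + bit (n ≡ᵇ a) ≡ 1
left-pointer-count zero    zero    z≤n     = refl
left-pointer-count (suc n) zero    z≤n     = trans (+-identityʳ _) (cong suc (ℕΣ.sum-replicate-zero n))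
left-pointer-count (suc n) (suc a) (s≤s p) = left-pointer-count n a p

right-pointer-count : ∀ n a → a ≤ n → bit (0 ≡ᵇ a) + ℕΣ.sum {n} (λ j → bit (suc (toℕ j) ≡ᵇ a)) ≡ 1
right-pointer-count n       zero    _       = cong suc (ℕΣ.sum-replicate-zero n)
right-pointer-count (suc n) (suc a) (s≤s p) = right-pointer-count n a p

multiplicity-pointerSeq : ∀ n σ (u : Fin (suc n)) → multiplicity (toℕ u) (pointerSeq n σ) ≡ 2
multiplicity-pointerSeq n σ u = begin
  multiplicity a (pointerSeq n σ)
    ≡⟨ cong (multiplicity a) (pointerSeq-shape n σ) ⟩
  bit (0 ≡ᵇ a) + multiplicity a (pointerPairs (leftPointer σ) ++ [ n ])
    ≡⟨ cong (bit (0 ≡ᵇ a) +_) (multiplicity-++ a (pointerPairs (leftPointer σ)) [ n ]) ⟩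
  bit (0 ≡ᵇ a) + (multiplicity a (pointerPairs (leftPointer σ)) + (bit (n ≡ᵇ a) + 0))
    ≡⟨ cong (λ k → bit (0 ≡ᵇ a) + (k + (bit (n ≡ᵇ a) + 0))) (trans (multiplicity-pointerPairs a (leftPointer σ)) (sym (ℕΣ.sum-permute pointers σ))) ⟩
  bit (0 ≡ᵇ a) + (ℕΣ.sum pointers + (bit (n ≡ᵇ a) + 0))
    ≡⟨ cong (λ k → bit (0 ≡ᵇ a) + (k + (bit (n ≡ᵇ a) + 0))) (ℕΣ.∑-distrib-+ left right) ⟩
  bit (0 ≡ᵇ a) + ((ℕΣ.sum left + ℕΣ.sum right) + (bit (n ≡ᵇ a) + 0))
    ≡⟨ regroup (bit (0 ≡ᵇ a)) (ℕΣ.sum left) (ℕΣ.sum right) (bit (n ≡ᵇ a)) ⟩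
  (bit (0 ≡ᵇ a) + ℕΣ.sum right) + (ℕΣ.sum left + bit (n ≡ᵇ a))
    ≡⟨ cong₂ _+_ (right-pointer-count n a a≤n) (left-pointer-count n a a≤n) ⟩
  2 ∎
  where
  open ≡-Reasoning
  a = toℕ u
  a≤n : a ≤ n
  a≤n = ≤-pred (toℕ<n u)
  left right pointers : Fin n → ℕ
  left  j = bit (toℕ j ≡ᵇ a)
  right j = bit (suc (toℕ j) ≡ᵇ a)
  pointers j = left j + right j
  regroup : ∀ r l l′ r′ → r + ((l + l′) + (r′ + 0)) ≡ (r + l′) + (l + r′)
  regroup = solve-∀

-- Prefix parities along the pointer sequence

prefixesAt : ℕ → (ℕ → Bool) → Bool → List ℕ → Bool
prefixesAt v F acc []       = false
prefixesAt v F acc (x ∷ xs) = ((x ≡ᵇ v) ∧ acc) xor prefixesAt v F (acc xor F x) xs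

xorMap-if : ∀ F b x xs → xorMap F (if b then x ∷ xs else xs) ≡ (b ∧ F x) xor xorMap F xs
xorMap-if F true  x xs = refl
xorMap-if F false x xs = refl

-- The xor of F over the stretch between the two occurrences of v is the xor of the running
-- prefixes at these occurrences; F v ≡ false makes the endpoints themselves irrelevant.
xorMap-between≡prefixesAt : ∀ v F → F v ≡ false → ∀ w s acc → multiplicity v w + s ≡ 2 →
  xorMap F (between v s w) ≡ prefixesAt v F acc w xor ((s ≡ᵇ 1) ∧ acc)
xorMap-between≡prefixesAt v F Fv≡false []      .2 acc refl = refl
xorMap-between≡prefixesAt v F Fv≡false (x ∷ w) s  acc hw with x ≡ᵇ v in x≡v
... | true rewrite ≡ᵇ⇒≡′ x v x≡v | Fv≡false | xor-identityʳ acc =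
  trans (xorMap-between≡prefixesAt v F Fv≡false w (suc s) acc (trans (+-suc _ s) hw))
        (pass-occurrence (suc[m+n]≡2⇒n≤1 (multiplicity v w) s hw) acc (prefixesAt v F acc w))
  where
  pass-occurrence : ∀ {s} → s ≤ 1 → ∀ a p → p xor ((suc s ≡ᵇ 1) ∧ a) ≡ (a xor p) xor ((s ≡ᵇ 1) ∧ a)
  pass-occurrence z≤n       false false = refl
  pass-occurrence z≤n       false true  = refl
  pass-occurrence z≤n       true  false = refl
  pass-occurrence z≤n       true  true  = refl
  pass-occurrence (s≤s z≤n) false false = refl
  pass-occurrence (s≤s z≤n) false true  = refl
  pass-occurrence (s≤s z≤n) true  false = refl
  pass-occurrence (s≤s z≤n) true  true  = refl
... | false = begin
  xorMap F (if s ≡ᵇ 1 then x ∷ between v s w else between v s w)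
    ≡⟨ xorMap-if F (s ≡ᵇ 1) x (between v s w) ⟩
  ((s ≡ᵇ 1) ∧ F x) xor xorMap F (between v s w)
    ≡⟨ cong (((s ≡ᵇ 1) ∧ F x) xor_) (xorMap-between≡prefixesAt v F Fv≡false w s (acc xor F x) hw) ⟩
  ((s ≡ᵇ 1) ∧ F x) xor (prefixesAt v F (acc xor F x) w xor ((s ≡ᵇ 1) ∧ (acc xor F x)))
    ≡⟨ cong (λ y → ((s ≡ᵇ 1) ∧ F x) xor (prefixesAt v F (acc xor F x) w xor y)) (∧-distribˡ-xor (s ≡ᵇ 1) acc (F x)) ⟩
  ((s ≡ᵇ 1) ∧ F x) xor (prefixesAt v F (acc xor F x) w xor (((s ≡ᵇ 1) ∧ acc) xor ((s ≡ᵇ 1) ∧ F x)))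
    ≡⟨ cancel-outer ((s ≡ᵇ 1) ∧ F x) (prefixesAt v F (acc xor F x) w) ((s ≡ᵇ 1) ∧ acc) ⟩
  prefixesAt v F (acc xor F x) w xor ((s ≡ᵇ 1) ∧ acc) ∎
  where
  open ≡-Reasoning
  cancel-outer : ∀ a q b → a xor (q xor (b xor a)) ≡ q xor b
  cancel-outer false q     false = refl
  cancel-outer false q     true  = refl
  cancel-outer true  false false = refl
  cancel-outer true  false true  = refl
  cancel-outer true  true  false = refl
  cancel-outer true  true  true  = refl

pairPrefix : ∀ {k} → (ℕ → Bool) → (Fin k → ℕ) → Fin k → Bool
pairPrefix F c Fin.zero    = false
pairPrefix F c (Fin.suc i) = (F (c Fin.zero) xor F (suc (c Fin.zero))) xor pairPrefix F (c ∘ Fin.suc) i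

pairContribution : ℕ → (ℕ → Bool) → ℕ → Bool → Bool
pairContribution v F x acc = ((x ≡ᵇ v) ∧ acc) xor ((suc x ≡ᵇ v) ∧ (acc xor F x))

prefixesAt-pointerPairs : ∀ v F rest → (∀ a → prefixesAt v F a rest ≡ false) → ∀ {k} (c : Fin k → ℕ) acc →
  prefixesAt v F acc (pointerPairs c ++ rest) ≡ ⨁ (λ i → pairContribution v F (c i) (acc xor pairPrefix F c i))
prefixesAt-pointerPairs v F rest no-v {zero}  c acc = no-v acc
prefixesAt-pointerPairs v F rest no-v {suc k} c acc = begin
  ((c₀ ≡ᵇ v) ∧ acc) xor (((suc c₀ ≡ᵇ v) ∧ (acc xor F c₀)) xor prefixesAt v F acc′ (pointerPairs (c ∘ Fin.suc) ++ rest))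
    ≡⟨ sym (xor-assoc ((c₀ ≡ᵇ v) ∧ acc) _ _) ⟩
  pairContribution v F c₀ acc xor prefixesAt v F acc′ (pointerPairs (c ∘ Fin.suc) ++ rest)
    ≡⟨ cong₂ _xor_ (cong (pairContribution v F c₀) (sym (xor-identityʳ acc)))
                   (prefixesAt-pointerPairs v F rest no-v (c ∘ Fin.suc) acc′) ⟩
  pairContribution v F c₀ (acc xor false) xor ⨁ (λ i → pairContribution v F (c (Fin.suc i)) (acc′ xor P i))
    ≡⟨ cong (pairContribution v F c₀ (acc xor false) xor_)
            (⊕Σ.sum-cong-≗ (λ i → cong (pairContribution v F (c (Fin.suc i))) (regroup (P i)))) ⟩
  ⨁ (λ i → pairContribution v F (c i) (acc xor pairPrefix F c i)) ∎
  where
  open ≡-Reasoning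
  c₀ : ℕ
  c₀ = c Fin.zero
  acc′ : Bool
  acc′ = (acc xor F c₀) xor F (suc c₀)
  P : Fin k → Bool
  P = pairPrefix F (c ∘ Fin.suc)
  regroup : ∀ p → acc′ xor p ≡ acc xor ((F c₀ xor F (suc c₀)) xor p)
  regroup p = trans (xor-assoc (acc xor F c₀) _ p)
                    (trans (xor-assoc acc (F c₀) _) (cong (acc xor_) (sym (xor-assoc (F c₀) _ p))))

pairPrefix-cong : ∀ F F′ {k} (c : Fin k → ℕ) → (∀ j → F (c j) xor F (suc (c j)) ≡ F′ (c j) xor F′ (suc (c j))) →
  ∀ i → pairPrefix F c i ≡ pairPrefix F′ c i
pairPrefix-cong F F′ c same Fin.zero    = refl
pairPrefix-cong F F′ c same (Fin.suc i) = cong₂ _xor_ (same Fin.zero) (pairPrefix-cong F F′ (c ∘ Fin.suc) (same ∘ Fin.suc) i)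

otherPart≡xor : ∀ G side v u → otherPart G side v u ≡ side u xor side v
otherPart≡xor G side v u with side v
... | true  = sym (xor-comm (side u) true)
... | false = sym (xor-identityʳ (side u))

extendℕ-xor : ∀ {m} (g h : Fin m → Bool) b → (∀ u → h u ≡ g u xor b) → ∀ {x} → x < m → extendℕ h x ≡ extendℕ g x xor b
extendℕ-xor g h b h≡g {zero}  (s≤s _)   = h≡g Fin.zero
extendℕ-xor g h b h≡g {suc x} (s≤s x<m) = extendℕ-xor (g ∘ Fin.suc) (h ∘ Fin.suc) b (h≡g ∘ Fin.suc) x<m

xor-cancelʳ : ∀ p q b → (p xor b) xor (q xor b) ≡ p xor q
xor-cancelʳ false false false = refl
xor-cancelʳ false false true  = refl
xor-cancelʳ false true  false = refl
xor-cancelʳ false true  true  = refl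
xor-cancelʳ true  false false = refl
xor-cancelʳ true  false true  = refl
xor-cancelʳ true  true  false = refl
xor-cancelʳ true  true  true  = refl

suc≡ᵇ-false : ∀ a → (suc a ≡ᵇ a) ≡ false
suc≡ᵇ-false zero    = refl
suc≡ᵇ-false (suc a) = suc≡ᵇ-false a

⨁-reindex : ∀ {n} (σ : Permutation′ n) (h : ℕ → Bool) (g : Fin n → Bool) →
  ⨁ (λ i → h (leftPointer σ i) ∧ g i) ≡ ⨁ (λ j → h (toℕ j) ∧ g (σ ⟨$⟩ˡ j))
⨁-reindex σ h g = trans (⊕Σ.sum-cong-≗ (λ i → cong (λ k → h (leftPointer σ i) ∧ g k) (sym (inverseˡ σ))))
                        (sym (⊕Σ.sum-permute (λ j → h (toℕ j) ∧ g (σ ⟨$⟩ˡ j)) σ))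

belowℕ : (ℕ → Bool) → ℕ → Bool
belowℕ f zero    = false
belowℕ f (suc a) = f a

⨁-indicator-suc : ∀ {m} (g : Fin m → Bool) x → ⨁ (λ u → (suc (toℕ u) ≡ᵇ x) ∧ g u) ≡ belowℕ (extendℕ g) x
⨁-indicator-suc {m} g zero    = ⊕Σ.sum-replicate-zero m
⨁-indicator-suc     g (suc x) = ⨁-indicator g x

module _ {n} (σ : Permutation′ n) (side : Fin (suc n) → Bool) where

  private
    G : TwoRootedGraph
    G = overlapGraph n σ
    c : Fin n → ℕ
    c = leftPointer σ
    t : ℕ → Bool
    t = extendℕ side

  odd-δ≡⨁-pairContribution : ∀ v → toℕ v < n →
    let F = extendℕ (otherPart G side v) in
    odd (δ G (otherPart G side v) v) ≡ ⨁ (λ i → pairContribution (toℕ v) F (c i) (F 0 xor pairPrefix F c i))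
  odd-δ≡⨁-pairContribution v v<n = begin
    odd (δ G (otherPart G side v) v)
      ≡⟨ odd-δ-overlapGraph n σ (multiplicity-pointerSeq n σ) (otherPart G side v) v ⟩
    xorMap F (between a 0 (pointerSeq n σ))
      ≡⟨ xorMap-between≡prefixesAt a F Fa≡false (pointerSeq n σ) 0 false (trans (+-identityʳ _) (multiplicity-pointerSeq n σ v)) ⟩
    prefixesAt a F false (pointerSeq n σ) xor false
      ≡⟨ trans (xor-identityʳ _) (cong (prefixesAt a F false) (pointerSeq-shape n σ)) ⟩
    ((0 ≡ᵇ a) ∧ false) xor prefixesAt a F (F 0) (pointerPairs c ++ [ n ])
      ≡⟨ cong (_xor prefixesAt a F (F 0) (pointerPairs c ++ [ n ])) (∧-zeroʳ (0 ≡ᵇ a)) ⟩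
    prefixesAt a F (F 0) (pointerPairs c ++ [ n ])
      ≡⟨ prefixesAt-pointerPairs a F [ n ] no-occurrence-in-tail c (F 0) ⟩
    ⨁ (λ i → pairContribution a F (c i) (F 0 xor pairPrefix F c i)) ∎
    where
    open ≡-Reasoning
    a = toℕ v
    F = extendℕ (otherPart G side v)
    Fa≡false : F a ≡ false
    Fa≡false = trans (extendℕ-toℕ (otherPart G side v) v) (trans (otherPart≡xor G side v v) (xor-same (side v)))
    no-occurrence-in-tail : ∀ acc → prefixesAt a F acc [ n ] ≡ false
    no-occurrence-in-tail acc rewrite ≡ᵇ-comm n a | <⇒≡ᵇ-false v<n = refl

  prefixParity : Fin n → Bool
  prefixParity i = pairPrefix t c i xor t (c i)

  prefixParityℕ : ℕ → Bool
  prefixParityℕ = extendℕ (prefixParity ∘ (σ ⟨$⟩ˡ_))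

  odd-δ-otherPart : side Fin.zero ≡ false → ∀ v → toℕ v < n →
    odd (δ G (otherPart G side v) v) ≡ prefixParityℕ (toℕ v) xor belowℕ prefixParityℕ (toℕ v)
  odd-δ-otherPart x∈V₁ v v<n = begin
    odd (δ G (otherPart G side v) v)
      ≡⟨ odd-δ≡⨁-pairContribution v v<n ⟩
    ⨁ (λ i → pairContribution a F (c i) (F 0 xor pairPrefix F c i))
      ≡⟨ ⊕Σ.sum-cong-≗ contribution ⟩
    ⨁ (λ i → ((c i ≡ᵇ a) xor (suc (c i) ≡ᵇ a)) ∧ prefixParity i)
      ≡⟨ ⊕Σ.sum-cong-≗ (λ i → ∧-distribʳ-xor (prefixParity i) (c i ≡ᵇ a) (suc (c i) ≡ᵇ a)) ⟩
    ⨁ (λ i → ((c i ≡ᵇ a) ∧ prefixParity i) xor ((suc (c i) ≡ᵇ a) ∧ prefixParity i))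
      ≡⟨ ⊕Σ.∑-distrib-+ (λ i → (c i ≡ᵇ a) ∧ prefixParity i) (λ i → (suc (c i) ≡ᵇ a) ∧ prefixParity i) ⟩
    ⨁ (λ i → (c i ≡ᵇ a) ∧ prefixParity i) xor ⨁ (λ i → (suc (c i) ≡ᵇ a) ∧ prefixParity i)
      ≡⟨ cong₂ _xor_ (⨁-reindex σ (_≡ᵇ a) prefixParity) (⨁-reindex σ (λ x → suc x ≡ᵇ a) prefixParity) ⟩
    ⨁ (λ j → (toℕ j ≡ᵇ a) ∧ prefixParity (σ ⟨$⟩ˡ j)) xor ⨁ (λ j → (suc (toℕ j) ≡ᵇ a) ∧ prefixParity (σ ⟨$⟩ˡ j))
      ≡⟨ cong₂ _xor_ (⨁-indicator (prefixParity ∘ (σ ⟨$⟩ˡ_)) a) (⨁-indicator-suc (prefixParity ∘ (σ ⟨$⟩ˡ_)) a) ⟩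
    prefixParityℕ a xor belowℕ prefixParityℕ a ∎
    where
    open ≡-Reasoning
    a = toℕ v
    b = side v
    F = extendℕ (otherPart G side v)
    F-shift : ∀ {x} → x < suc n → F x ≡ t x xor b
    F-shift = extendℕ-xor side (otherPart G side v) b (otherPart≡xor G side v)
    c<n : ∀ i → c i < n
    c<n i = toℕ<n (σ ⟨$⟩ʳ i)
    prefixes-agree : ∀ i → pairPrefix F c i ≡ pairPrefix t c i
    prefixes-agree = pairPrefix-cong F t c (λ j →
      trans (cong₂ _xor_ (F-shift (m<n⇒m<1+n (c<n j))) (F-shift (s≤s (c<n j)))) (xor-cancelʳ (t (c j)) (t (suc (c j))) b))
    contribution : ∀ i → pairContribution a F (c i) (F 0 xor pairPrefix F c i) ≡ ((c i ≡ᵇ a) xor (suc (c i) ≡ᵇ a)) ∧ prefixParity i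
    contribution i
      rewrite F-shift {0} (s≤s z≤n) | x∈V₁ | prefixes-agree i | F-shift (m<n⇒m<1+n (c<n i))
      with c i ≡ᵇ a in ci≡a
    ... | true rewrite ≡ᵇ⇒≡′ (c i) a ci≡a | suc≡ᵇ-false a | extendℕ-toℕ side v =
      trans (xor-identityʳ _) (xor-comm b (pairPrefix t c i))
    ... | false with suc (c i) ≡ᵇ a
    ...   | true  = trans (cong (_xor (t (c i) xor b)) (xor-comm b (pairPrefix t c i))) (xor-cancelʳ (pairPrefix t c i) (t (c i)) b)
    ...   | false = refl

  prefixParityℕ-true : IsParityCut G side → side Fin.zero ≡ false → Odd G (δ G (V₂ G side) Fin.zero) →
    ∀ a → a < n → prefixParityℕ a ≡ true
  prefixParityℕ-true cut x∈V₁ odd-x zero 0<n = begin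
    prefixParityℕ 0                                    ≡⟨ sym (xor-identityʳ _) ⟩
    prefixParityℕ 0 xor false                          ≡⟨ sym (odd-δ-otherPart x∈V₁ Fin.zero 0<n) ⟩
    odd (δ G (otherPart G side Fin.zero) Fin.zero)     ≡⟨ cong (λ S → odd (δ G S Fin.zero)) x-sees-V₂ ⟩
    odd (δ G (V₂ G side) Fin.zero)                     ≡⟨ odd-true (δ G (V₂ G side) Fin.zero) odd-x ⟩
    true                                               ∎
    where
    open ≡-Reasoning
    x-sees-V₂ : otherPart G side Fin.zero ≡ V₂ G side
    x-sees-V₂ rewrite x∈V₁ = refl
  prefixParityℕ-true cut x∈V₁ odd-x (suc a) a+1<n = begin
    prefixParityℕ (suc a)  ≡⟨ xor≡false⇒≡ (trans (sym formula) (odd-false (δ G (otherPart G side v) v) (cut v v≢x v≢y))) ⟩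
    prefixParityℕ a        ≡⟨ prefixParityℕ-true cut x∈V₁ odd-x a (<-trans (n<1+n a) a+1<n) ⟩
    true                   ∎
    where
    open ≡-Reasoning
    a+1<1+n : suc a < suc n
    a+1<1+n = m<n⇒m<1+n a+1<n
    v : Fin (suc n)
    v = fromℕ< a+1<1+n
    toℕ-v : toℕ v ≡ suc a
    toℕ-v = toℕ-fromℕ< a+1<1+n
    v≢x : v ≢ Fin.zero
    v≢x v≡x with () ← trans (sym toℕ-v) (cong toℕ v≡x)
    v≢y : v ≢ fromℕ n
    v≢y v≡y = <-irrefl (trans (sym toℕ-v) (trans (cong toℕ v≡y) (toℕ-fromℕ n))) a+1<n
    formula : odd (δ G (otherPart G side v) v) ≡ prefixParityℕ (suc a) xor prefixParityℕ a
    formula = trans (odd-δ-otherPart x∈V₁ v (subst (_< n) (sym toℕ-v) a+1<n))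
                    (cong (λ k → prefixParityℕ k xor belowℕ prefixParityℕ k) toℕ-v)

  prefixParity≡prefixParityℕ : ∀ i → prefixParity i ≡ prefixParityℕ (c i)
  prefixParity≡prefixParityℕ i =
    sym (trans (extendℕ-toℕ (prefixParity ∘ (σ ⟨$⟩ˡ_)) (σ ⟨$⟩ʳ i)) (cong prefixParity (inverseˡ σ)))

pairPrefix-suc : ∀ F {k} (c : Fin (suc k) → ℕ) (i : Fin k) →
  pairPrefix F c (Fin.suc i) ≡ (pairPrefix F c (inject₁ i) xor F (c (inject₁ i))) xor F (suc (c (inject₁ i)))
pairPrefix-suc F c Fin.zero    = xor-identityʳ _
pairPrefix-suc F c (Fin.suc i) = begin
  B xor pairPrefix F (c ∘ Fin.suc) (Fin.suc i)
    ≡⟨ cong (B xor_) (pairPrefix-suc F (c ∘ Fin.suc) i) ⟩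
  B xor ((P xor L) xor R)
    ≡⟨ sym (xor-assoc B (P xor L) R) ⟩
  (B xor (P xor L)) xor R
    ≡⟨ cong (_xor R) (sym (xor-assoc B P L)) ⟩
  ((B xor P) xor L) xor R ∎
  where
  open ≡-Reasoning
  B = F (c Fin.zero) xor F (suc (c Fin.zero))
  P = pairPrefix F (c ∘ Fin.suc) (inject₁ i)
  L = F (c (Fin.suc (inject₁ i)))
  R = F (suc (c (Fin.suc (inject₁ i))))

labels-cannot-propagate : ∀ {k} (σ : Permutation′ (suc k)) (t : ℕ → Bool) → t 0 ≡ false → t (suc k) ≡ true →
  t (leftPointer σ Fin.zero) ≡ true → (∀ i → t (leftPointer σ (Fin.suc i)) ≡ t (suc (leftPointer σ (inject₁ i)))) → ⊥
labels-cannot-propagate {k} σ t t0≡false tk≡true first≡true step = bit≢2 (t (suc (c (fromℕ k)))) (+-cancelˡ-≡ B _ _ (begin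
  B + bit (t (suc (c (fromℕ k))))           ≡⟨ sym (ℕΣ.sum-init-last {k} (λ i → bit (t (suc (c i))))) ⟩
  ℕΣ.sum (λ i → bit (t (suc (c i))))        ≡⟨ sum-right-pointers ⟩
  A + 1                                      ≡⟨ cong (_+ 1) (trans (sym sum-left-pointers) sum-left-pointers′) ⟩
  (1 + B) + 1                                ≡⟨ +-comm (1 + B) 1 ⟩
  2 + B                                      ≡⟨ +-comm 2 B ⟩
  B + 2                                      ∎))
  where
  open ≡-Reasoning
  c : Fin (suc k) → ℕ
  c = leftPointer σ
  A B : ℕ
  A = ℕΣ.sum {k} (λ j → bit (t (suc (toℕ j))))
  B = ℕΣ.sum {k} (λ i → bit (t (suc (c (inject₁ i)))))
  bit≢2 : ∀ b → bit b ≢ 2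
  bit≢2 true  ()
  bit≢2 false ()
  sum-left-pointers : ℕΣ.sum (λ i → bit (t (c i))) ≡ A
  sum-left-pointers = trans (sym (ℕΣ.sum-permute {suc k} (λ j → bit (t (toℕ j))) σ)) (cong (λ b → bit b + A) t0≡false)
  sum-left-pointers′ : ℕΣ.sum (λ i → bit (t (c i))) ≡ 1 + B
  sum-left-pointers′ = cong₂ _+_ (cong bit first≡true) (ℕΣ.sum-cong-≗ (λ i → cong bit (step i)))
  sum-right-pointers : ℕΣ.sum (λ i → bit (t (suc (c i)))) ≡ A + 1
  sum-right-pointers = begin
    ℕΣ.sum (λ i → bit (t (suc (c i))))
      ≡⟨ sym (ℕΣ.sum-permute {suc k} (λ j → bit (t (suc (toℕ j)))) σ) ⟩
    ℕΣ.sum {suc k} (λ j → bit (t (suc (toℕ j))))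
      ≡⟨ ℕΣ.sum-init-last {k} (λ j → bit (t (suc (toℕ j)))) ⟩
    ℕΣ.sum {k} (λ j → bit (t (suc (toℕ (inject₁ j))))) + bit (t (suc (toℕ (fromℕ k))))
      ≡⟨ cong₂ _+_ (ℕΣ.sum-cong-≗ {k} (λ j → cong (λ x → bit (t (suc x))) (toℕ-inject₁ j)))
                   (cong (λ x → bit (t (suc x))) (toℕ-fromℕ k)) ⟩
    A + bit (t (suc k))
      ≡⟨ cong (λ b → A + bit b) tk≡true ⟩
    A + 1 ∎

prefixParity-propagates : ∀ {k} (σ : Permutation′ (suc k)) side → (∀ i → prefixParity σ side i ≡ true) →
  ∀ i → extendℕ side (leftPointer σ (Fin.suc i)) ≡ extendℕ side (suc (leftPointer σ (inject₁ i)))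
prefixParity-propagates σ side all-true i = flip (begin
  (true xor t (suc (c (inject₁ i)))) xor t (c (Fin.suc i))
    ≡⟨ cong (λ p → (p xor t (suc (c (inject₁ i)))) xor t (c (Fin.suc i))) (sym (all-true (inject₁ i))) ⟩
  (prefixParity σ side (inject₁ i) xor t (suc (c (inject₁ i)))) xor t (c (Fin.suc i))
    ≡⟨ cong (_xor t (c (Fin.suc i))) (sym (pairPrefix-suc t c i)) ⟩
  prefixParity σ side (Fin.suc i)
    ≡⟨ all-true (Fin.suc i) ⟩
  true ∎)
  where
  open ≡-Reasoning
  t = extendℕ side
  c = leftPointer σ
  flip : ∀ {a b} → (true xor a) xor b ≡ true → b ≡ a
  flip {true}  {true}  _ = refl
  flip {false} {false} _ = refl

mainTheorem8 : (n : ℕ) (σ : Permutation′ n) → ¬ PropertyB (overlapGraph n σ)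
mainTheorem8 zero    σ (side , _ , x∈V₁ , y∈V₂ , _) with () ← trans (sym x∈V₁) y∈V₂
mainTheorem8 (suc k) σ (side , cut , x∈V₁ , y∈V₂ , odd-x , _) =
  labels-cannot-propagate σ (extendℕ side) x∈V₁ y∈V₂′ (all-true Fin.zero) (prefixParity-propagates σ side all-true)
  where
  all-true : ∀ i → prefixParity σ side i ≡ true
  all-true i = trans (prefixParity≡prefixParityℕ σ side i)
                     (prefixParityℕ-true σ side cut x∈V₁ odd-x (leftPointer σ i) (toℕ<n (σ ⟨$⟩ʳ i)))
  y∈V₂′ : extendℕ side (suc k) ≡ true
  y∈V₂′ = trans (cong (extendℕ side) (sym (toℕ-fromℕ (suc k)))) (trans (extendℕ-toℕ side (fromℕ (suc k))) y∈V₂)
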